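{- If there is a long-refinement graph $G$ with $\deg(G) = \{1,3\}$, then there is also a long-refinement graph $\hat G$ with $\deg(\hat G) = \{2,3\}$ and $|\hat G| \in \{|G|-1, |G|\}$.
   Context: All graphs are finite, simple, undirected, with monochromatic initial colouring. Colour Refinement computes $\chi^0_G$ constant and $\chi^i_G(v) = \big(\chi^{i-1}_G(v), \{\!\{\chi^{i-1}_G(w) \mid w \in N(v)\}\!\}\big)$; $\pi^i_G$ is the partition of $V(G)$ into colour classes of $\chi^i_G$, and $\mathrm{WL}_1(G)$ is the least $j \geq 0$ with $\pi^j_G = \pi^{j+1}_G$. A long-refinement graph is a graph $G$ with $\mathrm{WL}_1(G) = |G|-1$. $\deg(G) = \{\deg(v) \mid v \in V(G)\}$. -}

module Defs where

open import Data.Nat using (ℕ; zero; suc; _+_; _∸_; _<_)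
open import Data.Bool using (Bool; true; false; _∧_; if_then_else_)
open import Data.Fin using (Fin; zero; suc)
open import Data.Product using (_×_; ∃)
open import Data.Sum using (_⊎_)
open import Relation.Nullary using (¬_)
open import Relation.Binary.PropositionalEquality using (_≡_)

record Graph : Set where
  field
    n       : ℕ
    adj     : Fin n → Fin n → Bool
    sym     : ∀ u v → adj u v ≡ adj v u
    irrefl  : ∀ v → adj v v ≡ false
open Graph public

order : Graph → ℕ
order G = n G

countF : ∀ {m} → (Fin m → Bool) → ℕ
countF {zero}  p = 0
countF {suc m} p = (if p zero then 1 else 0) + countF (λ i → p (suc i))

allF : ∀ {m} → (Fin m → Bool) → Bool
allF {zero}  p = true
allF {suc m} p = p zero ∧ allF (λ i → p (suc i))

_==_ : ℕ → ℕ → Bool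
zero  == zero  = true
zero  == suc _ = false
suc _ == zero  = false
suc a == suc b = a == b

deg : (G : Graph) → Fin (n G) → ℕ
deg G v = countF (adj G v)

-- sameColour G i v w  =  true  iff  χ^i_G(v) = χ^i_G(w)  (i.e. v, w in the same
-- class of π^i_G).  χ^0 is constant.  χ^{i+1}(v) = χ^{i+1}(w) iff
-- χ^i(v) = χ^i(w) and the multisets {{χ^i(x) | x ∈ N(v)}} and
-- {{χ^i(x) | x ∈ N(w)}} coincide, i.e. for every χ^i-colour class
-- (represented by a vertex u) v and w have equally many neighbours in it.
sameColour : (G : Graph) → ℕ → Fin (n G) → Fin (n G) → Bool
sameColour G zero    v w = true
sameColour G (suc i) v w =
  sameColour G i v w ∧
  allF (λ u → countF (λ x → adj G v x ∧ sameColour G i x u)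
           == countF (λ x → adj G w x ∧ sameColour G i x u))

Stable : Graph → ℕ → Set
Stable G j = ∀ v w → sameColour G j v w ≡ sameColour G (suc j) v w

IsWL1 : Graph → ℕ → Set
IsWL1 G j = Stable G j × (∀ k → k < j → ¬ Stable G k)

LongRefinement : Graph → Set
LongRefinement G = IsWL1 G (order G ∸ 1)

DegSet₂ : Graph → ℕ → ℕ → Set
DegSet₂ G a b =
  (∀ v → deg G v ≡ a ⊎ deg G v ≡ b) ×
  (∃ λ v → deg G v ≡ a) × (∃ λ v → deg G v ≡ b)

-- Call the degree-1 vertices of G leaves and the degree-3 vertices inner.
--  (1) In a long-refinement graph each of the |G|-1 unstable rounds creates a
--      new colour class, so the final partition is discrete.  Two adjacent
--      leaves could never be told apart, hence do not exist.
--  (2) From round 1 on, leaves and inner vertices are separated; the colour of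
--      a leaf at round i+1 is that of its neighbour at round i, and the
--      refinement of the inner vertices only depends on inner colours.  So if
--      the partition of the inner vertices stalls once, the whole colouring
--      is stable.  Long refinement thus makes the inner vertices split in
--      every round, which leaves room for at most two leaves.
--  (3) One leaf u: the colouring of Ĝ = G - u at round i is the colouring of
--      G at round i+1, restricted to V(G) ∖ {u}.
--  (4) Two leaves u, u': adding the edge uu' changes no partition π^i.
module Submission where

open import Defs
open import Data.Nat using (ℕ; zero; suc; _+_; _∸_; _<_; _≤_; z≤n; s≤s; _<ᵇ_)
open import Data.Nat.Properties
  using (≤-refl; ≤-trans; ≤-pred; <-cmp; <ᵇ⇒<; <⇒<ᵇ; +-comm; +-assoc; +-suc; +-identityʳ;
         +-cancelʳ-≡; ≰⇒>; m≤n⇒m≤1+n; <-≤-trans; ≤-<-trans; n≤1+n; <-irrefl; suc-injective; +-monoʳ-≤)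
open import Data.Bool using (Bool; true; false; _∧_; _∨_; not; if_then_else_; T)
open import Data.Bool.Properties using (∧-identityʳ; ∧-zeroʳ; ∧-comm; ∨-comm; ∨-identityʳ)
open import Data.Fin using (Fin; zero; suc; punchIn; punchOut; toℕ)
open import Data.Fin.Properties using (punchInᵢ≢i; punchIn-punchOut; toℕ-injective; toℕ<n)
  renaming (_≟_ to _≟ᶠ_)
open import Data.Product using (Σ; _×_; _,_; proj₁; proj₂; ∃)
open import Data.Sum using (_⊎_; inj₁; inj₂)
open import Data.Empty using (⊥; ⊥-elim)
open import Data.Unit using (tt)
open import Relation.Nullary using (¬_; yes; no; does)
open import Relation.Binary using (tri<; tri≈; tri>)
open import Relation.Binary.PropositionalEquality
  using (_≡_; _≢_; refl; trans; cong; cong₂; subst; subst₂; module ≡-Reasoning)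
  renaming (sym to ≡-sym)

true≢false : true ≢ false
true≢false ()

true-or-false : (b : Bool) → b ≡ true ⊎ b ≡ false
true-or-false true  = inj₁ refl
true-or-false false = inj₂ refl

∧-elim : ∀ {a b} → a ∧ b ≡ true → a ≡ true × b ≡ true
∧-elim {true} {true} _ = refl , refl

∧-intro : ∀ {a b} → a ≡ true → b ≡ true → a ∧ b ≡ true
∧-intro refl refl = refl

∧-falseˡ : ∀ {a} b → a ≡ false → a ∧ b ≡ false
∧-falseˡ b refl = refl

∧-trueˡ : ∀ {a} b → a ≡ true → a ∧ b ≡ b
∧-trueˡ b refl = refl

not-false : ∀ {b} → not b ≡ false → b ≡ true
not-false {true} _ = refl

∧-absorb : ∀ {a b} → (b ≡ true → a ≡ true) → a ∧ b ≡ b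
∧-absorb {true}  {b}     _ = refl
∧-absorb {false} {true}  h with h refl
... | ()
∧-absorb {false} {false} _ = refl

∧-insert : ∀ {b q p : Bool} → (b ∧ q ≡ true → p ≡ true) → b ∧ q ≡ b ∧ (p ∧ q)
∧-insert {false} _ = refl
∧-insert {true} {false} {p} _ = ≡-sym (∧-zeroʳ p)
∧-insert {true} {true}  {p} h rewrite h refl = refl

_≟ᵇ_ : ∀ {m} → Fin m → Fin m → Bool
i ≟ᵇ j = does (i ≟ᶠ j)

≟ᵇ-refl : ∀ {m} (i : Fin m) → (i ≟ᵇ i) ≡ true
≟ᵇ-refl i with i ≟ᶠ i
... | yes _ = refl
... | no ne = ⊥-elim (ne refl)

≟ᵇ-≢ : ∀ {m} {i j : Fin m} → i ≢ j → (i ≟ᵇ j) ≡ false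
≟ᵇ-≢ {i = i} {j} ne with i ≟ᶠ j
... | yes e = ⊥-elim (ne e)
... | no _  = refl

≟ᵇ-sound : ∀ {m} {i j : Fin m} → (i ≟ᵇ j) ≡ true → i ≡ j
≟ᵇ-sound {i = i} {j} h with i ≟ᶠ j
... | yes e = e

==-sound : ∀ {a b} → (a == b) ≡ true → a ≡ b
==-sound {zero}  {zero}  _ = refl
==-sound {suc a} {suc b} h = cong suc (==-sound h)

==-refl : ∀ a → (a == a) ≡ true
==-refl zero    = refl
==-refl (suc a) = ==-refl a

==-complete : ∀ {a b} → a ≡ b → (a == b) ≡ true
==-complete {a} refl = ==-refl a

==-sym : ∀ a b → (a == b) ≡ (b == a)
==-sym zero    zero    = refl
==-sym zero    (suc b) = refl
==-sym (suc a) zero    = refl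
==-sym (suc a) (suc b) = ==-sym a b

==-+ʳ : ∀ t a b → ((a + t) == (b + t)) ≡ (a == b)
==-+ʳ t a b rewrite +-comm a t | +-comm b t = cancelˡ t
  where
    cancelˡ : ∀ t → ((t + a) == (t + b)) ≡ (a == b)
    cancelˡ zero    = refl
    cancelˡ (suc t) = cancelˡ t

1≢3 : 1 ≢ 3
1≢3 ()

suc-pred : ∀ {k} → Fin k → suc (k ∸ 1) ≡ k
suc-pred {suc k} _ = refl

𝟙 : Bool → ℕ
𝟙 b = if b then 1 else 0

countF-ext : ∀ {m} {p q : Fin m → Bool} → (∀ i → p i ≡ q i) → countF p ≡ countF q
countF-ext {zero}  e = refl
countF-ext {suc m} e = cong₂ _+_ (cong 𝟙 (e zero)) (countF-ext (λ i → e (suc i)))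

allF-ext : ∀ {m} {p q : Fin m → Bool} → (∀ i → p i ≡ q i) → allF p ≡ allF q
allF-ext {zero}  e = refl
allF-ext {suc m} e = cong₂ _∧_ (e zero) (allF-ext (λ i → e (suc i)))

allF-true : ∀ {m} {p : Fin m → Bool} → allF p ≡ true → ∀ i → p i ≡ true
allF-true {suc m} h zero    = proj₁ (∧-elim h)
allF-true {suc m} h (suc i) = allF-true (proj₂ (∧-elim h)) i

allF-intro : ∀ {m} {p : Fin m → Bool} → (∀ i → p i ≡ true) → allF p ≡ true
allF-intro {zero}  h = refl
allF-intro {suc m} h = ∧-intro (h zero) (allF-intro (λ i → h (suc i)))

allF-false : ∀ {m} {p : Fin m → Bool} → allF p ≡ false → ∃ λ i → p i ≡ false
allF-false {suc m} {p} h with true-or-false (p zero)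
... | inj₂ e = zero , e
... | inj₁ e with allF-false {p = λ i → p (suc i)} (trans (≡-sym (∧-trueˡ _ e)) h)
... | i , e' = suc i , e'

allF-has-false : ∀ {m} {p : Fin m → Bool} (i : Fin m) → p i ≡ false → allF p ≡ false
allF-has-false {p = p} i pi with true-or-false (allF p)
... | inj₁ h = ⊥-elim (true≢false (trans (≡-sym (allF-true h i)) pi))
... | inj₂ h = h

allF-dec : ∀ {m} (p : Fin m → Bool) → (∀ i → p i ≡ true) ⊎ (∃ λ i → p i ≡ false)
allF-dec p with true-or-false (allF p)
... | inj₁ h = inj₁ (allF-true h)
... | inj₂ h = inj₂ (allF-false h)

allF-const : ∀ {m} (i : Fin m) (b : Bool) → allF {m} (λ _ → b) ≡ b
allF-const {m}     i true  = allF-intro {m} {λ _ → true} (λ _ → refl)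
allF-const {suc m} i false = refl

countF-punch : ∀ {m} (p : Fin (suc m) → Bool) (t : Fin (suc m)) →
  countF p ≡ 𝟙 (p t) + countF (λ i → p (punchIn t i))
countF-punch p zero = refl
countF-punch {suc m} p (suc t) = begin
  𝟙 (p zero) + countF (λ i → p (suc i))
    ≡⟨ cong (𝟙 (p zero) +_) (countF-punch (λ i → p (suc i)) t) ⟩
  𝟙 (p zero) + (𝟙 (p (suc t)) + rest)
    ≡⟨ ≡-sym (+-assoc (𝟙 (p zero)) _ rest) ⟩
  (𝟙 (p zero) + 𝟙 (p (suc t))) + rest
    ≡⟨ cong (_+ rest) (+-comm (𝟙 (p zero)) _) ⟩
  (𝟙 (p (suc t)) + 𝟙 (p zero)) + rest
    ≡⟨ +-assoc (𝟙 (p (suc t))) _ rest ⟩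
  𝟙 (p (suc t)) + (𝟙 (p zero) + rest) ∎
  where
    open ≡-Reasoning
    rest = countF (λ i → p (suc (punchIn t i)))

allF-punch : ∀ {m} (p : Fin (suc m) → Bool) (t : Fin (suc m)) →
  allF p ≡ p t ∧ allF (λ i → p (punchIn t i))
allF-punch p zero = refl
allF-punch {suc m} p (suc t) with p zero | p (suc t) | allF-punch (λ i → p (suc i)) t
... | true  | b     | e = e
... | false | true  | e = refl
... | false | false | e = refl

countF-false : ∀ {m} {p : Fin m → Bool} → (∀ i → p i ≡ false) → countF p ≡ 0
countF-false {zero}  h = refl
countF-false {suc m} h rewrite h zero = countF-false (λ i → h (suc i))

countF-zero : ∀ {m} {p : Fin m → Bool} → countF p ≡ 0 → ∀ i → p i ≡ false
countF-zero {suc m} {p} h zero with p zero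
... | false = refl
countF-zero {suc m} {p} h (suc i) with p zero
... | false = countF-zero h i

countF-witness : ∀ {m} {p : Fin m → Bool} → countF p ≢ 0 → ∃ λ i → p i ≡ true
countF-witness {zero}  h = ⊥-elim (h refl)
countF-witness {suc m} {p} h with true-or-false (p zero)
... | inj₁ e = zero , e
... | inj₂ e with countF-witness {p = λ i → p (suc i)}
                   (λ z → h (trans (cong (λ b → 𝟙 b + countF (λ i → p (suc i))) e) z))
... | i , e' = suc i , e'

countF-≤ : ∀ {m} (p : Fin m → Bool) → countF p ≤ m
countF-≤ {zero}  p = z≤n
countF-≤ {suc m} p with p zero
... | true  = s≤s (countF-≤ _)
... | false = m≤n⇒m≤1+n (countF-≤ _)

countF-full : ∀ {m} {p : Fin m → Bool} → m ≤ countF p → ∀ i → p i ≡ true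
countF-full {suc m} {p} h i with true-or-false (p zero)
countF-full {suc m} {p} h zero    | inj₁ e = e
countF-full {suc m} {p} h (suc i) | inj₁ e rewrite e = countF-full (≤-pred h) i
... | inj₂ e rewrite e = ⊥-elim (<-irrefl refl (≤-trans h (countF-≤ (λ i → p (suc i)))))

countF-mono : ∀ {m} {p q : Fin m → Bool} → (∀ i → p i ≡ true → q i ≡ true) → countF p ≤ countF q
countF-mono {zero} h = z≤n
countF-mono {suc m} {p} {q} h with true-or-false (p zero)
... | inj₁ e rewrite e | h zero e = s≤s (countF-mono (λ i → h (suc i)))
... | inj₂ e rewrite e with q zero
... | true  = m≤n⇒m≤1+n (countF-mono (λ i → h (suc i)))
... | false = countF-mono (λ i → h (suc i))

countF-strict : ∀ {m} {p q : Fin m → Bool} → (∀ i → p i ≡ true → q i ≡ true) →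
  (j : Fin m) → p j ≡ false → q j ≡ true → countF p < countF q
countF-strict {suc m} {p} {q} h zero pj qj rewrite pj | qj = s≤s (countF-mono (λ i → h (suc i)))
countF-strict {suc m} {p} {q} h (suc j) pj qj with true-or-false (p zero)
... | inj₁ e rewrite e | h zero e = s≤s (countF-strict (λ i → h (suc i)) j pj qj)
... | inj₂ e rewrite e with q zero
... | true  = m≤n⇒m≤1+n (countF-strict (λ i → h (suc i)) j pj qj)
... | false = countF-strict (λ i → h (suc i)) j pj qj

countF-complement : ∀ {m} (p : Fin m → Bool) → countF (λ i → not (p i)) + countF p ≡ m
countF-complement {zero}  p = refl
countF-complement {suc m} p with p zero
... | true  = trans (+-suc _ _) (cong suc (countF-complement _))
... | false = cong suc (countF-complement _)

countF-rest : ∀ {m} {p : Fin (suc m) → Bool} {t k} → p t ≡ true → countF p ≡ suc k →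
  countF (λ i → p (punchIn t i)) ≡ k
countF-rest {p = p} {t} pt h =
  suc-injective (trans (cong (λ b → 𝟙 b + countF (λ i → p (punchIn t i))) (≡-sym pt))
                       (trans (≡-sym (countF-punch p t)) h))

countF-one-unique : ∀ {m} {p : Fin m → Bool} → countF p ≡ 1 → ∀ i j → p i ≡ true → p j ≡ true → i ≡ j
countF-one-unique {suc m} {p} h i j pi pj with i ≟ᶠ j
... | yes e = e
... | no ne = ⊥-elim (true≢false (trans (≡-sym pj') (countF-zero (countF-rest {p = p} pi h) (punchOut ne))))
  where
    pj' : p (punchIn i (punchOut ne)) ≡ true
    pj' = trans (cong p (punchIn-punchOut ne)) pj

countF-single : ∀ {m} (a f : Fin m → Bool) (w : Fin m) → countF a ≡ 1 → a w ≡ true →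
  countF (λ z → a z ∧ f z) ≡ 𝟙 (f w)
countF-single {suc m} a f w ca aw = begin
  countF (λ z → a z ∧ f z)
    ≡⟨ countF-punch (λ z → a z ∧ f z) w ⟩
  𝟙 (a w ∧ f w) + countF (λ i → a (punchIn w i) ∧ f (punchIn w i))
    ≡⟨ cong₂ _+_ (cong 𝟙 (∧-trueˡ (f w) aw)) (countF-false others) ⟩
  𝟙 (f w) + 0
    ≡⟨ +-identityʳ _ ⟩
  𝟙 (f w) ∎
  where
    open ≡-Reasoning
    others : ∀ i → a (punchIn w i) ∧ f (punchIn w i) ≡ false
    others i = ∧-falseˡ _ (countF-zero (countF-rest {p = a} aw ca) i)

countF-add-point : ∀ {m} (a s : Fin (suc m) → Bool) (t : Fin (suc m)) → a t ≡ false →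
  countF (λ z → (a z ∨ (z ≟ᵇ t)) ∧ s z) ≡ countF (λ z → a z ∧ s z) + 𝟙 (s t)
countF-add-point a s t at = begin
  countF (λ z → (a z ∨ (z ≟ᵇ t)) ∧ s z)
    ≡⟨ countF-punch (λ z → (a z ∨ (z ≟ᵇ t)) ∧ s z) t ⟩
  𝟙 ((a t ∨ (t ≟ᵇ t)) ∧ s t) + countF (λ i → (a (punchIn t i) ∨ (punchIn t i ≟ᵇ t)) ∧ s (punchIn t i))
    ≡⟨ cong₂ _+_ (cong 𝟙 at-t) (countF-ext off-t) ⟩
  𝟙 (s t) + rest
    ≡⟨ +-comm (𝟙 (s t)) rest ⟩
  rest + 𝟙 (s t)
    ≡⟨ cong (_+ 𝟙 (s t)) (≡-sym (trans (countF-punch (λ z → a z ∧ s z) t)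
                                       (cong (λ b → 𝟙 b + rest) (∧-falseˡ (s t) at)))) ⟩
  countF (λ z → a z ∧ s z) + 𝟙 (s t) ∎
  where
    open ≡-Reasoning
    rest = countF (λ i → a (punchIn t i) ∧ s (punchIn t i))
    at-t : (a t ∨ (t ≟ᵇ t)) ∧ s t ≡ s t
    at-t rewrite at | ≟ᵇ-refl t = refl
    off-t : ∀ i → (a (punchIn t i) ∨ (punchIn t i ≟ᵇ t)) ∧ s (punchIn t i) ≡ a (punchIn t i) ∧ s (punchIn t i)
    off-t i rewrite ≟ᵇ-≢ (punchInᵢ≢i t i) | ∨-identityʳ (a (punchIn t i)) = refl

countF-point : ∀ {m} (p : Fin m → Bool) (t : Fin m) → countF (λ z → p z ∧ (z ≟ᵇ t)) ≡ 𝟙 (p t)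
countF-point {suc m} p t =
  trans (countF-ext (λ z → ∧-comm (p z) (z ≟ᵇ t)))
        (countF-single (λ z → z ≟ᵇ t) p t (trans (countF-punch (λ z → z ≟ᵇ t) t) only-t) (≟ᵇ-refl t))
  where
    only-t : 𝟙 (t ≟ᵇ t) + countF (λ i → punchIn t i ≟ᵇ t) ≡ 1
    only-t rewrite ≟ᵇ-refl t = cong suc (countF-false (λ i → ≟ᵇ-≢ (punchInᵢ≢i t i)))

countF-at-most-two : ∀ {m} (p : Fin m → Bool) (u : Fin m) → p u ≡ true → countF p ≤ 2 →
  (∀ v → v ≢ u → p v ≡ false) ⊎
  (∃ λ u' → u ≢ u' × p u' ≡ true × (∀ v → v ≢ u → v ≢ u' → p v ≡ false))
countF-at-most-two {suc m} p u pu le = cases rest refl (≤-pred (subst (_≤ 2) split le))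
  where
    rest = countF (λ i → p (punchIn u i))
    split : countF p ≡ suc rest
    split = trans (countF-punch p u) (cong (λ b → 𝟙 b + rest) pu)
    at : ∀ {v} (ne : v ≢ u) → p v ≡ p (punchIn u (punchOut (λ e → ne (≡-sym e))))
    at ne = cong p (≡-sym (punchIn-punchOut (λ e → ne (≡-sym e))))
    Conclusion : Set
    Conclusion = (∀ v → v ≢ u → p v ≡ false) ⊎
                 (∃ λ u' → u ≢ u' × p u' ≡ true × (∀ v → v ≢ u → v ≢ u' → p v ≡ false))
    cases : ∀ k → rest ≡ k → k ≤ 1 → Conclusion
    cases zero e _ = inj₁ (λ v ne → trans (at ne) (countF-zero {p = λ i → p (punchIn u i)} e _))
    cases (suc zero) e _ with countF-witness {p = λ i → p (punchIn u i)} (λ z → 1≢0 (trans (≡-sym e) z))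
      where
        1≢0 : 1 ≢ 0
        1≢0 ()
    ... | x , px = inj₂ (punchIn u x , (λ q → punchInᵢ≢i u x (≡-sym q)) , px , others)
      where
        others : ∀ v → v ≢ u → v ≢ punchIn u x → p v ≡ false
        others v ne ne' with true-or-false (p v)
        ... | inj₂ f = f
        ... | inj₁ t = ⊥-elim (ne' (trans (≡-sym (punchIn-punchOut (λ e → ne (≡-sym e)))) (cong (punchIn u)
                         (countF-one-unique e _ x (trans (≡-sym (at ne)) t) px))))
    cases (suc (suc k)) _ (s≤s ())

-- Counting the classes of a Boolean equivalence relation R on a subset S of
-- Fin m: each class is represented by its least element.

record IsEquivalenceᵇ {m} (R : Fin m → Fin m → Bool) : Set where
  field
    reflexive  : ∀ v → R v v ≡ true
    symmetric  : ∀ v w → R v w ≡ true → R w v ≡ true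
    transitive : ∀ u v w → R u v ≡ true → R v w ≡ true → R u w ≡ true
open IsEquivalenceᵇ

T⇒true : ∀ {b} → T b → b ≡ true
T⇒true {true} _ = refl

true⇒T : ∀ {b} → b ≡ true → T b
true⇒T refl = tt

isLeast : ∀ {m} (R : Fin m → Fin m → Bool) (S : Fin m → Bool) → Fin m → Bool
isLeast R S v = S v ∧ allF (λ w → not (S w ∧ (R w v ∧ (toℕ w <ᵇ toℕ v))))

classes : ∀ {m} (R : Fin m → Fin m → Bool) (S : Fin m → Bool) → ℕ
classes R S = countF (isLeast R S)

isLeast-∈ : ∀ {m} {R : Fin m → Fin m → Bool} {S v} → isLeast R S v ≡ true → S v ≡ true
isLeast-∈ h = proj₁ (∧-elim h)

not-least : ∀ {m} {R : Fin m → Fin m → Bool} {S v w} → S w ≡ true → R w v ≡ true →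
  toℕ w < toℕ v → isLeast R S v ≡ false
not-least {R = R} {S} {v} {w} sw rwv lt with true-or-false (isLeast R S v)
... | inj₂ e = e
... | inj₁ e = ⊥-elim (contra (S w) (R w v) _ sw rwv (T⇒true (<⇒<ᵇ lt))
      (allF-true {p = λ w → not (S w ∧ (R w v ∧ (toℕ w <ᵇ toℕ v)))} (proj₂ (∧-elim e)) w))
  where
    contra : ∀ x y z → x ≡ true → y ≡ true → z ≡ true → not (x ∧ (y ∧ z)) ≡ true → ⊥
    contra true true true _ _ _ ()

least-representative : ∀ {m} {R : Fin m → Fin m → Bool} {S} → IsEquivalenceᵇ R →
  ∀ (v : Fin m) → S v ≡ true → ∃ λ p → isLeast R S p ≡ true × R p v ≡ true
least-representative {m} {R} {S} eq v sv = descend m v (toℕ<n v) sv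
  where
    descend : ∀ b (v : Fin m) → toℕ v < b → S v ≡ true → ∃ λ p → isLeast R S p ≡ true × R p v ≡ true
    descend (suc b) v lt sv with true-or-false (isLeast R S v)
    ... | inj₁ r = v , r , reflexive eq v
    ... | inj₂ r with allF-false {p = λ w → not (S w ∧ (R w v ∧ (toℕ w <ᵇ toℕ v)))}
                        (trans (≡-sym (∧-trueˡ _ sv)) r)
    ... | w , e with ∧-elim (not-false e)
    ... | sw , e2 with ∧-elim e2
    ... | rwv , l with descend b w (<-≤-trans (<ᵇ⇒< _ _ (true⇒T l)) (≤-pred lt)) sw
    ... | p , rp , rpw = p , rp , transitive eq p w v rpw rwv

isLeast-finer : ∀ {m} {R R' : Fin m → Fin m → Bool} {S v} → (∀ a b → R' a b ≡ true → R a b ≡ true) →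
  isLeast R S v ≡ true → isLeast R' S v ≡ true
isLeast-finer {R = R} {R'} {S} {v} finer h with ∧-elim h
... | sv , a = ∧-intro sv (allF-intro (λ w → weaken (S w) (R w v) (R' w v) _ (finer w v) (allF-true a w)))
  where
    weaken : ∀ (x y y' l : Bool) → (y' ≡ true → y ≡ true) →
      not (x ∧ (y ∧ l)) ≡ true → not (x ∧ (y' ∧ l)) ≡ true
    weaken false y y'    l     _ _ = refl
    weaken true  y false l     _ _ = refl
    weaken true  y true  false _ _ = refl
    weaken true  y true  true  i h with i refl
    weaken true .true true true i () | refl

finer-more-classes : ∀ {m} {R R' : Fin m → Fin m → Bool} {S} → IsEquivalenceᵇ R → IsEquivalenceᵇ R' →
  (∀ a b → R' a b ≡ true → R a b ≡ true) → ∀ a b → S a ≡ true → S b ≡ true →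
  R a b ≡ true → R' a b ≡ false → classes R S < classes R' S
finer-more-classes {R = R} {R'} {S} eR eR' finer a b sa sb rab r'ab
  with least-representative {S = S} eR' a sa | least-representative {S = S} eR' b sb
... | p , rp , rpa | q , rq , rqb = compare (<-cmp (toℕ p) (toℕ q))
  where
    Rpq : R p q ≡ true
    Rpq = transitive eR p a q (finer p a rpa) (transitive eR a b q rab (finer b q (symmetric eR' q b rqb)))
    more : ∀ {x y} → isLeast R' S x ≡ true → R x y ≡ true → toℕ x < toℕ y → isLeast R' S y ≡ true →
      classes R S < classes R' S
    more {x} {y} lx rxy lt ly =
      countF-strict (λ i → isLeast-finer {R = R} {R'} {S} finer) y
        (not-least {R = R} {S} (isLeast-∈ {R = R'} {S} {x} lx) rxy lt) ly
    compare : _ → classes R S < classes R' S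
    compare (tri< lt _ _) = more rp Rpq lt rq
    compare (tri≈ _ e _) with toℕ-injective e
    ... | refl = ⊥-elim (true≢false (trans (≡-sym (transitive eR' a p b (symmetric eR' p a rpa) rqb)) r'ab))
    compare (tri> _ _ gt) = more rq (symmetric eR p q Rpq) gt rp

classes-pos : ∀ {m} {R : Fin m → Fin m → Bool} {S} → IsEquivalenceᵇ R → ∀ v → S v ≡ true → 1 ≤ classes R S
classes-pos {m} {R = R} {S} eR v sv with least-representative {S = S} eR v sv
... | p , rp , _ = subst (_< classes R S) (countF-false {m} {p = λ _ → false} (λ _ → refl))
                     (countF-strict {m} {p = λ _ → false} (λ i ()) p refl rp)

classes≤size : ∀ {m} (R : Fin m → Fin m → Bool) S → classes R S ≤ countF S
classes≤size R S = countF-mono {p = isLeast R S} {q = S} (λ i → isLeast-∈ {R = R} {S} {i})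

discrete : ∀ {m} {R : Fin m → Fin m → Bool} → IsEquivalenceᵇ R → m ≤ classes R (λ _ → true) →
  ∀ v w → R v w ≡ true → v ≡ w
discrete {R = R} eR h v w rvw with <-cmp (toℕ v) (toℕ w)
... | tri< lt _ _ = ⊥-elim (true≢false (trans (≡-sym (countF-full h w)) (not-least {R = R} {λ _ → true} refl rvw lt)))
... | tri≈ _ e _  = toℕ-injective e
... | tri> _ _ gt = ⊥-elim (true≢false (trans (≡-sym (countF-full h v))
                      (not-least {R = R} {λ _ → true} refl (symmetric eR v w rvw) gt)))

inclusion-or-witness : ∀ {m} (S : Fin m → Bool) (R R' : Fin m → Fin m → Bool) →
  (∀ a b → S a ≡ true → S b ≡ true → R a b ≡ true → R' a b ≡ true) ⊎
  (∃ λ a → ∃ λ b → S a ≡ true × S b ≡ true × R a b ≡ true × R' a b ≡ false)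
inclusion-or-witness S R R' with allF-dec (λ a → allF (λ b → not (S a ∧ (S b ∧ R a b)) ∨ R' a b))
... | inj₂ (a , e) with allF-false e
... | b , e2 = inj₂ (a , b , witness (S a) (S b) (R a b) (R' a b) e2)
  where
    witness : ∀ x y z u → not (x ∧ (y ∧ z)) ∨ u ≡ false → x ≡ true × y ≡ true × z ≡ true × u ≡ false
    witness true true true false _ = refl , refl , refl , refl
inclusion-or-witness S R R' | inj₁ h =
  inj₁ λ a b sa sb r → included (S a) (S b) (R a b) (R' a b) sa sb r (allF-true (h a) b)
  where
    included : ∀ x y z u → x ≡ true → y ≡ true → z ≡ true → not (x ∧ (y ∧ z)) ∨ u ≡ true → u ≡ true
    included true true true true _ _ _ _ = refl

module Refinement (G : Graph) where
  private
    V = Fin (n G)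

  sc : ℕ → V → V → Bool
  sc = sameColour G

  nbrCount : ℕ → V → V → ℕ
  nbrCount i v u = countF (λ x → adj G v x ∧ sc i x u)

  sc-suc-elim : ∀ i {v w} → sc (suc i) v w ≡ true → sc i v w ≡ true × (∀ u → nbrCount i v u ≡ nbrCount i w u)
  sc-suc-elim i {v} {w} h with ∧-elim h
  ... | same , counts = same , λ u → ==-sound (allF-true {p = λ u → nbrCount i v u == nbrCount i w u} counts u)

  sc-suc-intro : ∀ i {v w} → sc i v w ≡ true → (∀ u → nbrCount i v u ≡ nbrCount i w u) → sc (suc i) v w ≡ true
  sc-suc-intro i same counts = ∧-intro same (allF-intro (λ u → ==-complete (counts u)))

  sc-mono : ∀ i {v w} → sc (suc i) v w ≡ true → sc i v w ≡ true
  sc-mono i h = proj₁ (∧-elim h)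

  sc-weaken : ∀ i k {v w} → sc (i + k) v w ≡ true → sc i v w ≡ true
  sc-weaken i zero    h rewrite +-identityʳ i = h
  sc-weaken i (suc k) h rewrite +-suc i k = sc-weaken i k (sc-mono (i + k) h)

  sc-refl : ∀ i v → sc i v v ≡ true
  sc-refl zero    v = refl
  sc-refl (suc i) v = sc-suc-intro i (sc-refl i v) (λ _ → refl)

  sc-sym : ∀ i v w → sc i v w ≡ sc i w v
  sc-sym zero    v w = refl
  sc-sym (suc i) v w =
    cong₂ _∧_ (sc-sym i v w) (allF-ext (λ u → ==-sym (nbrCount i v u) (nbrCount i w u)))

  sc-trans : ∀ i {u v w} → sc i u v ≡ true → sc i v w ≡ true → sc i u w ≡ true
  sc-trans zero    _  _  = refl
  sc-trans (suc i) h1 h2 with sc-suc-elim i h1 | sc-suc-elim i h2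
  ... | a1 , b1 | a2 , b2 = sc-suc-intro i (sc-trans i a1 a2) (λ u → trans (b1 u) (b2 u))

  sc-equivalence : ∀ i → IsEquivalenceᵇ (sc i)
  sc-equivalence i = record
    { reflexive  = sc-refl i
    ; symmetric  = λ v w h → trans (sc-sym i w v) h
    ; transitive = λ u v w → sc-trans i
    }

  sc-cong : ∀ i {v w} → sc i v w ≡ true → ∀ u → sc i v u ≡ sc i w u
  sc-cong i {v} {w} h u with true-or-false (sc i v u) | true-or-false (sc i w u)
  ... | inj₁ a | inj₁ b = trans a (≡-sym b)
  ... | inj₂ a | inj₂ b = trans a (≡-sym b)
  ... | inj₁ a | inj₂ b = ⊥-elim (true≢false (trans (≡-sym (sc-trans i (trans (sc-sym i w v) h) a)) b))
  ... | inj₂ a | inj₁ b = ⊥-elim (true≢false (trans (≡-sym (sc-trans i h b)) a))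

  nbrCount-0 : ∀ v u → nbrCount 0 v u ≡ deg G v
  nbrCount-0 v u = countF-ext (λ x → ∧-identityʳ (adj G v x))

  sc-1 : ∀ v w → sc 1 v w ≡ (deg G v == deg G w)
  sc-1 v w = trans (allF-ext (λ u → cong₂ _==_ (nbrCount-0 v u) (nbrCount-0 w u))) (allF-const v _)

  sc-deg : ∀ i {v w} → sc (suc i) v w ≡ true → deg G v ≡ deg G w
  sc-deg i {v} {w} h = ==-sound (trans (≡-sym (sc-1 v w)) (sc-weaken 1 i h))

  sc-separates : ∀ i {v w} → deg G v ≢ deg G w → sc (suc i) v w ≡ false
  sc-separates i {v} {w} ne with true-or-false (sc (suc i) v w)
  ... | inj₁ h = ⊥-elim (ne (sc-deg i h))
  ... | inj₂ h = h

  sc-1-3 : ∀ i {v w} → deg G v ≡ 1 → deg G w ≡ 3 → sc (suc i) v w ≡ false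
  sc-1-3 i dv dw = sc-separates i (λ e → 1≢3 (trans (≡-sym dv) (trans e dw)))

  sc-3-1 : ∀ i {v w} → deg G v ≡ 3 → deg G w ≡ 1 → sc (suc i) v w ≡ false
  sc-3-1 i {v} {w} dv dw = trans (sc-sym (suc i) v w) (sc-1-3 i dw dv)

  unstable-witness : ∀ j → ¬ Stable G j → ∃ λ v → ∃ λ w → sc j v w ≡ true × sc (suc j) v w ≡ false
  unstable-witness j unstable with inclusion-or-witness (λ _ → true) (sc j) (sc (suc j))
  ... | inj₂ (v , w , _ , _ , a , b) = v , w , a , b
  ... | inj₁ incl = ⊥-elim (unstable stable)
    where
      stable : Stable G j
      stable v w with true-or-false (sc j v w)
      ... | inj₁ a = trans a (≡-sym (incl v w refl refl a))
      ... | inj₂ a = trans a (≡-sym (∧-falseˡ _ a))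

  leaf-neighbour : ∀ {x} → deg G x ≡ 1 → ∃ λ w → adj G x w ≡ true
  leaf-neighbour dx = countF-witness (λ e → 1≢0 (trans (≡-sym dx) e))
    where
      1≢0 : 1 ≢ 0
      1≢0 ()

  leaf-neighbour-unique : ∀ {x w z} → deg G x ≡ 1 → adj G x w ≡ true → adj G x z ≡ true → z ≡ w
  leaf-neighbour-unique dx axw axz = countF-one-unique dx _ _ axz axw

  leaf-count : ∀ {x w} → deg G x ≡ 1 → adj G x w ≡ true → (f : V → Bool) →
    countF (λ z → adj G x z ∧ f z) ≡ 𝟙 (f w)
  leaf-count {x} {w} dx axw f = countF-single (adj G x) f w dx axw

  leaf-pullback : ∀ j {x y wx wy} → deg G x ≡ 1 → deg G y ≡ 1 → adj G x wx ≡ true → adj G y wy ≡ true →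
    sc (suc j) x y ≡ sc j wx wy
  leaf-pullback j {x} {y} {wx} {wy} dx dy ax ay = begin
    sc j x y ∧ allF (λ u → nbrCount j x u == nbrCount j y u)
      ≡⟨ cong (sc j x y ∧_) (allF-ext (λ u → cong₂ _==_ (leaf-count dx ax (λ z → sc j z u))
                                                         (leaf-count dy ay (λ z → sc j z u)))) ⟩
    sc j x y ∧ allF (λ u → 𝟙 (sc j wx u) == 𝟙 (sc j wy u))
      ≡⟨ cong (sc j x y ∧_) neighbours-agree ⟩
    sc j x y ∧ sc j wx wy
      ≡⟨ ∧-absorb (earlier j) ⟩
    sc j wx wy ∎
    where
      open ≡-Reasoning
      neighbours-agree : allF (λ u → 𝟙 (sc j wx u) == 𝟙 (sc j wy u)) ≡ sc j wx wy
      neighbours-agree with true-or-false (sc j wx wy)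
      ... | inj₁ h = trans (allF-intro (λ u → ==-complete (cong 𝟙 (sc-cong j h u)))) (≡-sym h)
      ... | inj₂ h = trans (allF-has-false wy (cong₂ _==_ (cong 𝟙 h) (cong 𝟙 (sc-refl j wy)))) (≡-sym h)
      earlier : ∀ j → sc j wx wy ≡ true → sc j x y ≡ true
      earlier zero    _ = refl
      earlier (suc j) h = trans (leaf-pullback j dx dy ax ay) (sc-mono j h)

  stable-suc : ∀ j → Stable G j → Stable G (suc j)
  stable-suc j st v w =
    trans (cong (_∧ allF (λ u → nbrCount j v u == nbrCount j w u)) (st v w))
          (cong (sc (suc j) v w ∧_) (allF-ext (λ u → cong₂ _==_ (counts v u) (counts w u))))
    where
      counts : ∀ x u → nbrCount j x u ≡ nbrCount (suc j) x u
      counts x u = countF-ext (λ z → cong (adj G x z ∧_) (st z u))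

-- (1) In a long-refinement graph, the final partition π^{|G|-1} is discrete.

module LongRefinementFacts (G : Graph) (lr : LongRefinement G) where
  open Refinement G
  private
    V = Fin (n G)

  -- every round before |G|-1 splits a class, so π^j has at least j+1 classes
  classes-grow : V → ∀ j → j ≤ n G ∸ 1 → suc j ≤ classes (sc j) (λ _ → true)
  classes-grow v zero    _  = classes-pos (sc-equivalence 0) v refl
  classes-grow v (suc j) le with unstable-witness j (proj₂ lr j le)
  ... | a , b , same , split =
    ≤-<-trans (classes-grow v j (≤-trans (n≤1+n j) le))
      (finer-more-classes (sc-equivalence j) (sc-equivalence (suc j)) (λ _ _ → sc-mono j) a b refl refl same split)

  final-discrete : ∀ v w → sc (n G ∸ 1) v w ≡ true → v ≡ w
  final-discrete v = discrete (sc-equivalence (n G ∸ 1))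
    (subst (_≤ classes (sc (n G ∸ 1)) (λ _ → true)) (suc-pred v) (classes-grow v (n G ∸ 1) ≤-refl))
    v

  -- two adjacent leaves would have the same colour in every round
  no-adjacent-leaves : ∀ {x y} → deg G x ≡ 1 → adj G x y ≡ true → deg G y ≡ 1 → ⊥
  no-adjacent-leaves {x} {y} dx axy dy =
    true≢false (trans (≡-sym (subst (λ z → adj G x z ≡ true) (≡-sym x≡y) axy)) (irrefl G x))
    where
      ayx : adj G y x ≡ true
      ayx = trans (Graph.sym G y x) axy
      twins : ∀ j → sc j x y ≡ true
      twins zero    = refl
      twins (suc j) = trans (leaf-pullback j dx dy axy ayx) (trans (sc-sym j y x) (twins j))
      x≡y : x ≡ y
      x≡y = final-discrete x y (twins (n G ∸ 1))

data LeafStructure (G : Graph) : Set where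
  one-leaf   : (u : Fin (n G)) → deg G u ≡ 1 → (∀ v → v ≢ u → deg G v ≡ 3) → LeafStructure G
  two-leaves : (u u' : Fin (n G)) → u ≢ u' → deg G u ≡ 1 → deg G u' ≡ 1 → adj G u u' ≡ false →
               (∀ v → v ≢ u → v ≢ u' → deg G v ≡ 3) → LeafStructure G

-- (2) A long-refinement graph with all degrees in {1,3} has at most two leaves.

module Degrees13 (G : Graph) (lr : LongRefinement G) (degs : ∀ v → deg G v ≡ 1 ⊎ deg G v ≡ 3) where
  open Refinement G
  open LongRefinementFacts G lr
  private
    V = Fin (n G)

  isLeaf : V → Bool
  isLeaf v = deg G v == 1

  isInner : V → Bool
  isInner v = not (isLeaf v)

  leaf⇒1 : ∀ {v} → isLeaf v ≡ true → deg G v ≡ 1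
  leaf⇒1 = ==-sound

  non-leaf⇒3 : ∀ {v} → isLeaf v ≡ false → deg G v ≡ 3
  non-leaf⇒3 {v} h with degs v
  ... | inj₁ e = ⊥-elim (true≢false (trans (≡-sym (==-complete e)) h))
  ... | inj₂ e = e

  non-leaf⇒inner : ∀ {v} → isLeaf v ≡ false → isInner v ≡ true
  non-leaf⇒inner h rewrite h = refl

  non-inner⇒leaf : ∀ {v} → isInner v ≡ false → isLeaf v ≡ true
  non-inner⇒leaf {v} h with isLeaf v
  ... | true = refl

  inner⇒3 : ∀ {v} → isInner v ≡ true → deg G v ≡ 3
  inner⇒3 {v} h with true-or-false (isLeaf v)
  ... | inj₁ e rewrite e = ⊥-elim (true≢false (≡-sym h))
  ... | inj₂ e = non-leaf⇒3 e

  3⇒inner : ∀ {v} → deg G v ≡ 3 → isInner v ≡ true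
  3⇒inner e rewrite e = refl

  leaf-neighbour-inner : ∀ {x w} → deg G x ≡ 1 → adj G x w ≡ true → deg G w ≡ 3
  leaf-neighbour-inner {x} {w} dx axw with degs w
  ... | inj₁ e = ⊥-elim (no-adjacent-leaves dx axw e)
  ... | inj₂ e = e

  InnerStalls : ℕ → Set
  InnerStalls j = ∀ a b → isInner a ≡ true → isInner b ≡ true → sc j a b ≡ true → sc (suc j) a b ≡ true

  inner-stalls-eq : ∀ j → InnerStalls j →
    ∀ a b → isInner a ≡ true → isInner b ≡ true → sc j a b ≡ sc (suc j) a b
  inner-stalls-eq j stalls a b ia ib with true-or-false (sc j a b)
  ... | inj₁ t = trans t (≡-sym (stalls a b ia ib t))
  ... | inj₂ f = trans f (≡-sym (∧-falseˡ _ f))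

  innerCount : ℕ → V → V → ℕ
  innerCount i x c = countF (λ z → isInner z ∧ (adj G x z ∧ sc i z c))

  leaf-class-members : ∀ i {x c wc} → isLeaf c ≡ true → adj G c wc ≡ true → ∀ z →
    adj G x z ∧ sc (suc (suc i)) z c ≡ adj G x z ∧ (isLeaf z ∧ sc (suc i) x wc)
  leaf-class-members i {x} {c} {wc} lc acw z with true-or-false (adj G x z) | true-or-false (isLeaf z)
  ... | inj₂ e | _      rewrite e = refl
  ... | inj₁ e | inj₁ l rewrite e | l = leaf-pullback (suc i) (leaf⇒1 l) (leaf⇒1 lc) (trans (Graph.sym G z x) e) acw
  ... | inj₁ e | inj₂ l rewrite e | l = sc-3-1 (suc i) (non-leaf⇒3 l) (leaf⇒1 lc)

  leaf-nbrs-if : ∀ x {β c} → β ≡ true → isLeaf c ≡ true →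
    countF (λ z → adj G x z ∧ (isLeaf z ∧ β)) ≡ nbrCount 1 x c
  leaf-nbrs-if x {β} {c} e lc = countF-ext (λ z → cong (adj G x z ∧_)
      (trans (cong (isLeaf z ∧_) e) (trans (∧-identityʳ (isLeaf z))
        (≡-sym (trans (sc-1 z c) (cong (deg G z ==_) (leaf⇒1 lc)))))))

  leaf-nbrs-if-not : ∀ x {β} → β ≡ false → countF (λ z → adj G x z ∧ (isLeaf z ∧ β)) ≡ 0
  leaf-nbrs-if-not x {β} e = countF-false (λ z → trans (cong (λ t → adj G x z ∧ (isLeaf z ∧ t)) e)
                               (trans (cong (adj G x z ∧_) (∧-zeroʳ (isLeaf z))) (∧-zeroʳ _)))

  inner-classes-suffice : ∀ i {a b} → isInner a ≡ true → isInner b ≡ true → sc (suc (suc i)) a b ≡ true →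
    allF (λ c → nbrCount (suc (suc i)) a c == nbrCount (suc (suc i)) b c) ≡
    allF (λ c → not (isInner c) ∨ (innerCount (suc (suc i)) a c == innerCount (suc (suc i)) b c))
  inner-classes-suffice i {a} {b} ia ib h = allF-ext per-class
    where
      I = suc (suc i)
      inner-class : ∀ x c → isInner c ≡ true → nbrCount I x c ≡ innerCount I x c
      inner-class x c ic = countF-ext only-inner
        where
          only-inner : ∀ z → adj G x z ∧ sc I z c ≡ isInner z ∧ (adj G x z ∧ sc I z c)
          only-inner z with true-or-false (isInner z)
          ... | inj₁ iz = ≡-sym (∧-trueˡ _ iz)
          ... | inj₂ iz = trans (cong (adj G x z ∧_) (sc-1-3 (suc i) (leaf⇒1 (non-inner⇒leaf iz)) (inner⇒3 ic)))
                                (trans (∧-zeroʳ _) (≡-sym (∧-falseˡ _ iz)))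
      per-class : ∀ c → (nbrCount I a c == nbrCount I b c)
                        ≡ (not (isInner c) ∨ (innerCount I a c == innerCount I b c))
      per-class c with true-or-false (isLeaf c)
      ... | inj₂ lc rewrite lc = cong₂ _==_ (inner-class a c (non-leaf⇒inner lc)) (inner-class b c (non-leaf⇒inner lc))
      ... | inj₁ lc with leaf-neighbour (leaf⇒1 lc)
      ... | wc , acw rewrite lc | countF-ext (leaf-class-members i {a} lc acw) | countF-ext (leaf-class-members i {b} lc acw)
          = leaf-class (true-or-false (sc (suc i) b wc))
        where
          same-side : sc (suc i) a wc ≡ sc (suc i) b wc
          same-side = sc-cong (suc i) (sc-mono (suc i) h) wc
          leaf-class : _ → (countF (λ z → adj G a z ∧ (isLeaf z ∧ sc (suc i) a wc))
                            == countF (λ z → adj G b z ∧ (isLeaf z ∧ sc (suc i) b wc))) ≡ true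
          leaf-class (inj₁ t) = ==-complete (trans (leaf-nbrs-if a (trans same-side t) lc)
                                  (trans (proj₂ (sc-suc-elim 1 (sc-weaken 2 i h)) c) (≡-sym (leaf-nbrs-if b t lc))))
          leaf-class (inj₂ f) = ==-complete (trans (leaf-nbrs-if-not a (trans same-side f)) (≡-sym (leaf-nbrs-if-not b f)))

  inner-stall-persists : ∀ i → InnerStalls (suc (suc i)) → InnerStalls (suc (suc (suc i)))
  inner-stall-persists i stalls a b ia ib h1 =
    ∧-intro h1 (trans (inner-classes-suffice (suc i) ia ib h1)
                 (trans (allF-ext same-inner-counts) (trans (≡-sym (inner-classes-suffice i ia ib h0)) all0)))
    where
      I = suc (suc i)
      h0 : sc I a b ≡ true
      h0 = sc-mono I h1
      all0 : allF (λ u → nbrCount I a u == nbrCount I b u) ≡ true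
      all0 = proj₂ (∧-elim h1)
      inner-count-stalls : ∀ x c → isInner c ≡ true → innerCount (suc I) x c ≡ innerCount I x c
      inner-count-stalls x c ic = countF-ext pointwise
        where
          pointwise : ∀ z → isInner z ∧ (adj G x z ∧ sc (suc I) z c) ≡ isInner z ∧ (adj G x z ∧ sc I z c)
          pointwise z with true-or-false (isInner z)
          ... | inj₁ iz = cong (λ t → isInner z ∧ (adj G x z ∧ t)) (≡-sym (inner-stalls-eq I stalls z c iz ic))
          ... | inj₂ iz = trans (∧-falseˡ _ iz) (≡-sym (∧-falseˡ _ iz))
      same-inner-counts : ∀ c → (not (isInner c) ∨ (innerCount (suc I) a c == innerCount (suc I) b c))
                                ≡ (not (isInner c) ∨ (innerCount I a c == innerCount I b c))
      same-inner-counts c with true-or-false (isInner c)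
      ... | inj₁ ic rewrite ic = cong₂ _==_ (inner-count-stalls a c ic) (inner-count-stalls b c ic)
      ... | inj₂ ic rewrite ic = refl

  leaves-follow : ∀ k → InnerStalls k → ∀ v w → deg G v ≡ 1 → deg G w ≡ 1 →
    sc (suc k) v w ≡ sc (suc (suc k)) v w
  leaves-follow k stalls v w dv dw with leaf-neighbour dv | leaf-neighbour dw
  ... | wv , av | ww , aw = begin
    sc (suc k) v w         ≡⟨ leaf-pullback k dv dw av aw ⟩
    sc k wv ww             ≡⟨ inner-stalls-eq k stalls wv ww (inner wv dv av) (inner ww dw aw) ⟩
    sc (suc k) wv ww       ≡⟨ ≡-sym (leaf-pullback (suc k) dv dw av aw) ⟩
    sc (suc (suc k)) v w   ∎
    where
      open ≡-Reasoning
      inner : ∀ x {y} → deg G y ≡ 1 → adj G y x ≡ true → isInner x ≡ true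
      inner x dy ayx = 3⇒inner (leaf-neighbour-inner dy ayx)

  stable-from-stalls : ∀ k → InnerStalls k → InnerStalls (suc k) → Stable G (suc k)
  stable-from-stalls k stalls stalls' v w with true-or-false (sc (suc k) v w)
  ... | inj₂ f = trans f (≡-sym (∧-falseˡ _ f))
  ... | inj₁ h with degs v | sc-deg k h
  ... | inj₂ d3 | dvw = inner-stalls-eq (suc k) stalls' v w (3⇒inner d3) (3⇒inner (trans (≡-sym dvw) d3))
  ... | inj₁ d1 | dvw = leaves-follow k stalls v w d1 (trans (≡-sym dvw) d1)

  -- round 1 separates exactly by degree, so the inner partition never splits there
  inner-stalls-0 : InnerStalls 0
  inner-stalls-0 a b ia ib _ = trans (sc-1 a b) (==-complete (trans (inner⇒3 ia) (≡-sym (inner⇒3 ib))))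

  inner-stall⇒stable : ∀ j → InnerStalls (suc j) → Stable G (suc (suc j))
  inner-stall⇒stable zero    stalls = stable-suc 1 (stable-from-stalls 0 inner-stalls-0 stalls)
  inner-stall⇒stable (suc i) stalls = stable-from-stalls (suc (suc i)) stalls (inner-stall-persists i stalls)

  inner-classes-grow : ∀ s → isInner s ≡ true → ∀ j → suc (suc j) < n G →
    suc j ≤ classes (sc (suc j)) isInner
  inner-classes-grow s is zero    _  = classes-pos (sc-equivalence 1) s is
  inner-classes-grow s is (suc j) lt with inclusion-or-witness isInner (sc (suc j)) (sc (suc (suc j)))
  ... | inj₁ stalls = ⊥-elim (proj₂ lr (suc (suc j)) (pred< lt) (inner-stall⇒stable j stalls))
    where
      pred< : ∀ {k N} → suc k < N → k < N ∸ 1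
      pred< {k} {suc N} (s≤s h) = h
  ... | inj₂ (a , b , ia , ib , same , split) =
    ≤-<-trans (inner-classes-grow s is j (≤-trans (n≤1+n _) lt))
      (finer-more-classes (sc-equivalence (suc j)) (sc-equivalence (suc (suc j))) (λ _ _ → sc-mono (suc j))
        a b ia ib same split)

  -- with c inner vertices and ≥ 3 leaves, round c+1 would need c+1 inner classes
  at-most-two-leaves : ∀ s → isInner s ≡ true → countF isLeaf ≤ 2
  at-most-two-leaves s is = ≤-pred (≰⇒> three-leaves-impossible)
    where
      c = countF isInner
      three-leaves-impossible : ¬ (3 ≤ countF isLeaf)
      three-leaves-impossible three = <-irrefl refl
        (≤-trans (inner-classes-grow s is c room) (classes≤size (sc (suc c)) isInner))
        where
          room : suc (suc c) < n G
          room = subst (_≤ n G) (+-comm c 3) (subst (c + 3 ≤_) (countF-complement isLeaf) (+-monoʳ-≤ c three))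

  leaf-structure : ∀ {u s} → deg G u ≡ 1 → deg G s ≡ 3 → LeafStructure G
  leaf-structure {u} {s} du ds
    with countF-at-most-two isLeaf u (==-complete du) (at-most-two-leaves s (3⇒inner ds))
  ... | inj₁ others = one-leaf u du (λ v ne → non-leaf⇒3 (others v ne))
  ... | inj₂ (u' , ne , lu' , others) =
    two-leaves u u' ne du (leaf⇒1 lu') nonadjacent (λ v n1 n2 → non-leaf⇒3 (others v n1 n2))
    where
      nonadjacent : adj G u u' ≡ false
      nonadjacent with true-or-false (adj G u u')
      ... | inj₁ t = ⊥-elim (no-adjacent-leaves du t (leaf⇒1 lu'))
      ... | inj₂ f = f

module NonemptyGraph (m : ℕ) (a : Fin (suc m) → Fin (suc m) → Bool)
                     (a-sym : ∀ u v → a u v ≡ a v u) (a-irrefl : ∀ v → a v v ≡ false) where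

  G : Graph
  G = record { n = suc m ; adj = a ; sym = a-sym ; irrefl = a-irrefl }

  open Refinement G

  -- (3) Deleting the only leaf u shifts the colouring by one round.
  module LeafDeletion (u : Fin (suc m)) (du : deg G u ≡ 1) (others : ∀ v → v ≢ u → deg G v ≡ 3) where

    e : Fin m → Fin (suc m)
    e = punchIn u

    Ĝ : Graph
    Ĝ = record { n = m ; adj = λ x y → a (e x) (e y)
               ; sym = λ x y → a-sym (e x) (e y) ; irrefl = λ x → a-irrefl (e x) }

    module R̂ = Refinement Ĝ

    e-inner : ∀ x → deg G (e x) ≡ 3
    e-inner x = others (e x) (punchInᵢ≢i u x)

    degree-split : ∀ x → 𝟙 (a (e x) u) + deg Ĝ x ≡ 3
    degree-split x = trans (≡-sym (countF-punch (a (e x)) u)) (e-inner x)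

    same-degree-same-adjacency : ∀ {x y} → deg Ĝ x ≡ deg Ĝ y → 𝟙 (a (e x) u) ≡ 𝟙 (a (e y) u)
    same-degree-same-adjacency {x} {y} d = +-cancelʳ-≡ (deg Ĝ y) _ _
      (trans (subst (λ k → 𝟙 (a (e x) u) + k ≡ 3) d (degree-split x)) (≡-sym (degree-split y)))

    -- from round 1 on, u forms a class of its own
    count-u : ∀ i v → nbrCount (suc i) v u ≡ 𝟙 (a v u)
    count-u i v = trans (countF-ext only-u) (countF-point (a v) u)
      where
        only-u : ∀ z → a v z ∧ sc (suc i) z u ≡ a v z ∧ (z ≟ᵇ u)
        only-u z with z ≟ᶠ u
        ... | yes refl = cong (a v z ∧_) (sc-refl (suc i) z)
        ... | no ne    = cong (a v z ∧_) (sc-3-1 i (others z ne) du)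

    colours-shift : ∀ i x y → sameColour Ĝ i x y ≡ sc (suc i) (e x) (e y)
    colours-shift zero x y = ≡-sym (trans (sc-1 (e x) (e y)) (==-complete (trans (e-inner x) (≡-sym (e-inner y)))))
    colours-shift (suc i) x y = begin
      sameColour Ĝ i x y ∧ allF (λ c → R̂.nbrCount i x c == R̂.nbrCount i y c)
        ≡⟨ cong₂ _∧_ (colours-shift i x y) counts-shifted ⟩
      sc (suc i) (e x) (e y) ∧ Q
        ≡⟨ ∧-insert {sc (suc i) (e x) (e y)} {Q} {P u} u-counts-agree ⟩
      sc (suc i) (e x) (e y) ∧ (P u ∧ Q)
        ≡⟨ cong (sc (suc i) (e x) (e y) ∧_) (≡-sym (trans (allF-punch P u) (cong (P u ∧_) (allF-ext P-off-u)))) ⟩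
      sc (suc i) (e x) (e y) ∧ allF P ∎
      where
        open ≡-Reasoning
        count : Fin m → Fin m → ℕ
        count v c = countF (λ z → a (e v) (e z) ∧ sc (suc i) (e z) (e c))
        Q : Bool
        Q = allF (λ c → count x c == count y c)
        P : Fin (suc m) → Bool
        P c = nbrCount (suc i) (e x) c == nbrCount (suc i) (e y) c
        counts-shifted : allF (λ c → R̂.nbrCount i x c == R̂.nbrCount i y c) ≡ Q
        counts-shifted = allF-ext (λ c → cong₂ _==_ (shifted x c) (shifted y c))
          where
            shifted : ∀ v c → R̂.nbrCount i v c ≡ count v c
            shifted v c = countF-ext (λ z → cong (a (e v) (e z) ∧_) (colours-shift i z c))
        -- the leaf u never lies in the class of an inner vertex e c
        count-in-G : ∀ v c → nbrCount (suc i) (e v) (e c) ≡ count v c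
        count-in-G v c = trans (countF-punch (λ z → a (e v) z ∧ sc (suc i) z (e c)) u)
          (cong (_+ count v c) (cong 𝟙 (trans (cong (a (e v) u ∧_) (sc-1-3 i du (e-inner c))) (∧-zeroʳ _))))
        P-off-u : ∀ c → P (e c) ≡ (count x c == count y c)
        P-off-u c = cong₂ _==_ (count-in-G x c) (count-in-G y c)
        -- equal colour in Ĝ means equal Ĝ-degree, hence equal adjacency to u
        u-counts-agree : sc (suc i) (e x) (e y) ∧ Q ≡ true → P u ≡ true
        u-counts-agree h = trans (cong₂ _==_ (count-u i (e x)) (count-u i (e y)))
          (==-complete (same-degree-same-adjacency
            (R̂.sc-deg i (trans (cong₂ _∧_ (colours-shift i x y) counts-shifted) h))))

    stable-shift : ∀ j → Stable G (suc j) → Stable Ĝ j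
    stable-shift j st x y = trans (colours-shift j x y) (trans (st (e x) (e y)) (≡-sym (colours-shift (suc j) x y)))

    stable-unshift : ∀ j → Stable Ĝ j → Stable G (suc j)
    stable-unshift j st v w with v ≟ᶠ u | w ≟ᶠ u
    ... | yes refl | yes refl = trans (sc-refl (suc j) v) (≡-sym (sc-refl (suc (suc j)) v))
    ... | yes refl | no nw = trans (sc-1-3 j du (others w nw)) (≡-sym (sc-1-3 (suc j) du (others w nw)))
    ... | no nv | yes refl = trans (sc-3-1 j (others v nv) du) (≡-sym (sc-3-1 (suc j) (others v nv) du))
    ... | no nv | no nw = subst₂ (λ v w → sc (suc j) v w ≡ sc (suc (suc j)) v w)
           (punchIn-punchOut (λ q → nv (≡-sym q))) (punchIn-punchOut (λ q → nw (≡-sym q)))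
           (trans (≡-sym (colours-shift j _ _)) (trans (st _ _) (colours-shift (suc j) _ _)))

    w : Fin (suc m)
    w = proj₁ (leaf-neighbour du)

    auw : a u w ≡ true
    auw = proj₂ (leaf-neighbour du)

    u≢w : u ≢ w
    u≢w q = true≢false (trans (≡-sym auw) (trans (cong (a u) (≡-sym q)) (a-irrefl u)))

    long-refinement : LongRefinement G → LongRefinement Ĝ
    long-refinement lr =
      stable-shift (m ∸ 1) (subst (Stable G) (≡-sym m-pos) (proj₁ lr)) ,
      λ k lt st → proj₂ lr (suc k) (subst (suc k <_) m-pos (s≤s lt)) (stable-unshift k st)
      where
        m-pos : suc (m ∸ 1) ≡ m
        m-pos = suc-pred (punchOut u≢w)

    -- u's neighbour gets degree 2; a further neighbour of it keeps degree 3
    degrees : DegSet₂ Ĝ 2 3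
    degrees = two-or-three , (xw , deg-xw) , (xz , deg-xz)
      where
        two-or-three : ∀ x → deg Ĝ x ≡ 2 ⊎ deg Ĝ x ≡ 3
        two-or-three x with a (e x) u | degree-split x
        ... | true  | h = inj₁ (suc-injective h)
        ... | false | h = inj₂ h
        xw : Fin m
        xw = punchOut u≢w
        awu : a (e xw) u ≡ true
        awu = trans (cong (λ t → a t u) (punchIn-punchOut u≢w)) (trans (a-sym w u) auw)
        deg-xw : deg Ĝ xw ≡ 2
        deg-xw = suc-injective (trans (cong (λ t → 𝟙 t + deg Ĝ xw) (≡-sym awu)) (degree-split xw))
        w-other-nbrs : countF (λ i → a w (e i)) ≡ 2
        w-other-nbrs = countF-rest {p = a w} (trans (a-sym w u) auw) (others w (λ q → u≢w (≡-sym q)))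
        z-data : ∃ λ z → a w (e z) ≡ true
        z-data = countF-witness (λ q → 2≢0 (trans (≡-sym w-other-nbrs) q))
          where
            2≢0 : 2 ≢ 0
            2≢0 ()
        xz : Fin m
        xz = proj₁ z-data
        -- e xz is not adjacent to u: otherwise it would be u's only neighbour w
        azu : a (e xz) u ≡ false
        azu with true-or-false (a (e xz) u)
        ... | inj₂ f = f
        ... | inj₁ t = ⊥-elim (true≢false (trans (≡-sym (proj₂ z-data))
                        (trans (cong (a w) (leaf-neighbour-unique du auw (trans (a-sym u (e xz)) t))) (a-irrefl w))))
        deg-xz : deg Ĝ xz ≡ 3
        deg-xz = trans (≡-sym (cong (λ t → 𝟙 t + deg Ĝ xz) azu)) (degree-split xz)

  -- (4) Joining the only two leaves u, u' by an edge preserves every π^i.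
  module LeafJoining (u u' : Fin (suc m)) (u≢u' : u ≢ u') (du : deg G u ≡ 1) (du' : deg G u' ≡ 1)
                     (nonadjacent : a u u' ≡ false) (others : ∀ v → v ≢ u → v ≢ u' → deg G v ≡ 3) where

    adj' : Fin (suc m) → Fin (suc m) → Bool
    adj' x y = a x y ∨ (((x ≟ᵇ u) ∧ (y ≟ᵇ u')) ∨ ((x ≟ᵇ u') ∧ (y ≟ᵇ u)))

    adj'-sym : ∀ x y → adj' x y ≡ adj' y x
    adj'-sym x y = cong₂ _∨_ (a-sym x y) (trans (∨-comm ((x ≟ᵇ u) ∧ (y ≟ᵇ u')) ((x ≟ᵇ u') ∧ (y ≟ᵇ u)))
                     (cong₂ _∨_ (∧-comm (x ≟ᵇ u') (y ≟ᵇ u)) (∧-comm (x ≟ᵇ u) (y ≟ᵇ u'))))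

    adj'-irrefl : ∀ x → adj' x x ≡ false
    adj'-irrefl x rewrite a-irrefl x = no-loop (x ≟ᵇ u) (x ≟ᵇ u') not-both
      where
        no-loop : ∀ p q → p ∧ q ≡ false → (p ∧ q) ∨ (q ∧ p) ≡ false
        no-loop true  true  ()
        no-loop true  false _ = refl
        no-loop false q     _ = ∧-zeroʳ q
        not-both : (x ≟ᵇ u) ∧ (x ≟ᵇ u') ≡ false
        not-both with true-or-false (x ≟ᵇ u)
        ... | inj₂ f = ∧-falseˡ _ f
        ... | inj₁ t with ≟ᵇ-sound {i = x} {u} t
        ... | refl = trans (∧-trueˡ _ t) (≟ᵇ-≢ u≢u')

    G' : Graph
    G' = record { n = suc m ; adj = adj' ; sym = adj'-sym ; irrefl = adj'-irrefl }

    module R' = Refinement G'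

    data Kind (x : Fin (suc m)) : Set where
      is-u  : x ≡ u → Kind x
      is-u' : x ≡ u' → Kind x
      other : x ≢ u → x ≢ u' → Kind x

    kind : ∀ x → Kind x
    kind x with x ≟ᶠ u | x ≟ᶠ u'
    ... | yes p | _     = is-u p
    ... | no _  | yes q = is-u' q
    ... | no p  | no q  = other p q

    counts-other : ∀ {x} → x ≢ u → x ≢ u' → (f : Fin (suc m) → Bool) →
      countF (λ z → adj' x z ∧ f z) ≡ countF (λ z → a x z ∧ f z)
    counts-other {x} n1 n2 f = countF-ext (λ z → cong (_∧ f z) (no-new-edge z))
      where
        no-new-edge : ∀ z → adj' x z ≡ a x z
        no-new-edge z rewrite ≟ᵇ-≢ n1 | ≟ᵇ-≢ n2 = ∨-identityʳ (a x z)

    counts-u : (f : Fin (suc m) → Bool) →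
      countF (λ z → adj' u z ∧ f z) ≡ countF (λ z → a u z ∧ f z) + 𝟙 (f u')
    counts-u f = trans (countF-ext (λ z → cong (_∧ f z) (new-edge z))) (countF-add-point (a u) f u' nonadjacent)
      where
        new-edge : ∀ z → adj' u z ≡ a u z ∨ (z ≟ᵇ u')
        new-edge z rewrite ≟ᵇ-refl u | ≟ᵇ-≢ u≢u' = cong (a u z ∨_) (∨-identityʳ (z ≟ᵇ u'))

    counts-u' : (f : Fin (suc m) → Bool) →
      countF (λ z → adj' u' z ∧ f z) ≡ countF (λ z → a u' z ∧ f z) + 𝟙 (f u)
    counts-u' f = trans (countF-ext (λ z → cong (_∧ f z) (new-edge z)))
                        (countF-add-point (a u') f u (trans (a-sym u' u) nonadjacent))
      where
        new-edge : ∀ z → adj' u' z ≡ a u' z ∨ (z ≟ᵇ u)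
        new-edge z rewrite ≟ᵇ-refl u' | ≟ᵇ-≢ (λ q → u≢u' (≡-sym q)) = refl

    newCount : ℕ → Fin (suc m) → Fin (suc m) → ℕ
    newCount i x c = countF (λ z → adj' x z ∧ sc i z c)

    extra : ℕ → Fin (suc m) → Fin (suc m) → ℕ
    extra i x c with kind x
    ... | is-u _    = 𝟙 (sc i u' c)
    ... | is-u' _   = 𝟙 (sc i u c)
    ... | other _ _ = 0

    newCount-split : ∀ i x c → newCount i x c ≡ nbrCount i x c + extra i x c
    newCount-split i x c with kind x
    ... | is-u refl   = counts-u (λ z → sc i z c)
    ... | is-u' refl  = counts-u' (λ z → sc i z c)
    ... | other p q   = trans (counts-other p q (λ z → sc i z c)) (≡-sym (+-identityʳ _))

    degree-change : ∀ x → (deg G x ≡ 1 × deg G' x ≡ 2) ⊎ (deg G x ≡ 3 × deg G' x ≡ 3)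
    degree-change x with kind x | trans (≡-sym (R'.nbrCount-0 x x)) (newCount-split 0 x x)
    ... | is-u refl  | d' = inj₁ (du , trans d' (cong (_+ 1) (trans (nbrCount-0 u u) du)))
    ... | is-u' refl | d' = inj₁ (du' , trans d' (cong (_+ 1) (trans (nbrCount-0 u' u') du')))
    ... | other p q  | d' = inj₂ (others x p q , trans d' (trans (+-identityʳ _) (trans (nbrCount-0 x x) (others x p q))))

    degree-partition-preserved : ∀ x y → (deg G' x == deg G' y) ≡ (deg G x == deg G y)
    degree-partition-preserved x y with degree-change x | degree-change y
    ... | inj₁ (d , d') | inj₁ (e , e') = trans (cong₂ _==_ d' e') (≡-sym (cong₂ _==_ d e))
    ... | inj₁ (d , d') | inj₂ (e , e') = trans (cong₂ _==_ d' e') (≡-sym (cong₂ _==_ d e))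
    ... | inj₂ (d , d') | inj₁ (e , e') = trans (cong₂ _==_ d' e') (≡-sym (cong₂ _==_ d e))
    ... | inj₂ (d , d') | inj₂ (e , e') = trans (cong₂ _==_ d' e') (≡-sym (cong₂ _==_ d e))

    -- from round 1 on, vertices of equal colour are both leaves or both inner,
    -- and the leaves u, u' then have partners of equal colour
    extra-agrees : ∀ i x y → sc (suc i) x y ≡ true → ∀ c → extra (suc i) x c ≡ extra (suc i) y c
    extra-agrees i x y h c with kind x | kind y
    ... | is-u refl  | is-u refl  = refl
    ... | is-u refl  | is-u' refl = cong 𝟙 (sc-cong (suc i) (trans (sc-sym (suc i) u' u) h) c)
    ... | is-u' refl | is-u refl  = cong 𝟙 (sc-cong (suc i) (trans (sc-sym (suc i) u u') h) c)
    ... | is-u' refl | is-u' refl = refl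
    ... | other _ _  | other _ _  = refl
    ... | is-u refl  | other p q  = ⊥-elim (true≢false (trans (≡-sym h) (sc-1-3 i du (others y p q))))
    ... | is-u' refl | other p q  = ⊥-elim (true≢false (trans (≡-sym h) (sc-1-3 i du' (others y p q))))
    ... | other p q  | is-u refl  = ⊥-elim (true≢false (trans (≡-sym h) (sc-3-1 i (others x p q) du)))
    ... | other p q  | is-u' refl = ⊥-elim (true≢false (trans (≡-sym h) (sc-3-1 i (others x p q) du')))

    counts-agree : ∀ i x y → sc i x y ≡ true →
      ∀ c → (newCount i x c == newCount i y c) ≡ (nbrCount i x c == nbrCount i y c)
    counts-agree zero x y _ c = begin
      (newCount 0 x c == newCount 0 y c)   ≡⟨ cong₂ _==_ (R'.nbrCount-0 x c) (R'.nbrCount-0 y c) ⟩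
      (deg G' x == deg G' y)               ≡⟨ degree-partition-preserved x y ⟩
      (deg G x == deg G y)                 ≡⟨ ≡-sym (cong₂ _==_ (nbrCount-0 x c) (nbrCount-0 y c)) ⟩
      (nbrCount 0 x c == nbrCount 0 y c)   ∎
      where open ≡-Reasoning
    counts-agree (suc i) x y h c = begin
      (newCount (suc i) x c == newCount (suc i) y c)
        ≡⟨ cong₂ _==_ (newCount-split (suc i) x c)
                      (trans (newCount-split (suc i) y c) (cong (_ +_) (≡-sym (extra-agrees i x y h c)))) ⟩
      ((nbrCount (suc i) x c + extra (suc i) x c) == (nbrCount (suc i) y c + extra (suc i) x c))
        ≡⟨ ==-+ʳ (extra (suc i) x c) (nbrCount (suc i) x c) (nbrCount (suc i) y c) ⟩
      (nbrCount (suc i) x c == nbrCount (suc i) y c) ∎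
      where open ≡-Reasoning

    colours-agree : ∀ i x y → sameColour G' i x y ≡ sc i x y
    colours-agree zero    x y = refl
    colours-agree (suc i) x y =
      trans (cong₂ _∧_ (colours-agree i x y) (allF-ext (λ c → cong₂ _==_ (same-classes x c) (same-classes y c))))
            guarded
      where
        same-classes : ∀ v c → R'.nbrCount i v c ≡ newCount i v c
        same-classes v c = countF-ext (λ z → cong (adj' v z ∧_) (colours-agree i z c))
        guarded : sc i x y ∧ allF (λ c → newCount i x c == newCount i y c)
                ≡ sc i x y ∧ allF (λ c → nbrCount i x c == nbrCount i y c)
        guarded with true-or-false (sc i x y)
        ... | inj₁ h = cong (sc i x y ∧_) (allF-ext (counts-agree i x y h))
        ... | inj₂ f rewrite f = refl

    long-refinement : LongRefinement G → LongRefinement G'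
    long-refinement lr =
      (λ v w → trans (colours-agree m v w) (trans (proj₁ lr v w) (≡-sym (colours-agree (suc m) v w)))) ,
      λ k lt st → proj₂ lr k lt
        (λ v w → trans (≡-sym (colours-agree k v w)) (trans (st v w) (colours-agree (suc k) v w)))

    -- u has degree 2 in G', and its G-neighbour (neither u nor u') degree 3
    degrees : DegSet₂ G' 2 3
    degrees = two-or-three , (u , new-degree-2 du) , (w , deg-w)
      where
        two-or-three : ∀ v → deg G' v ≡ 2 ⊎ deg G' v ≡ 3
        two-or-three v with degree-change v
        ... | inj₁ (_ , d') = inj₁ d'
        ... | inj₂ (_ , d') = inj₂ d'
        new-degree-2 : ∀ {v} → deg G v ≡ 1 → deg G' v ≡ 2
        new-degree-2 {v} d with degree-change v
        ... | inj₁ (_ , d') = d'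
        ... | inj₂ (d3 , _) = ⊥-elim (1≢3 (trans (≡-sym d) d3))
        w : Fin (suc m)
        w = proj₁ (leaf-neighbour du)
        auw : a u w ≡ true
        auw = proj₂ (leaf-neighbour du)
        w≢u : w ≢ u
        w≢u q = true≢false (trans (≡-sym auw) (trans (cong (a u) q) (a-irrefl u)))
        w≢u' : w ≢ u'
        w≢u' q = true≢false (trans (≡-sym auw) (trans (cong (a u) q) nonadjacent))
        deg-w : deg G' w ≡ 3
        deg-w with degree-change w
        ... | inj₂ (_ , d') = d'
        ... | inj₁ (d1 , _) = ⊥-elim (1≢3 (trans (≡-sym d1) (others w w≢u w≢u')))

corollary14 : (G : Graph) → LongRefinement G → DegSet₂ G 1 3 →
    Σ Graph (λ Ĝ → LongRefinement Ĝ × DegSet₂ Ĝ 2 3 ×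
      (order Ĝ ≡ order G ∸ 1 ⊎ order Ĝ ≡ order G))
corollary14 record { n = zero } _ (_ , (() , _) , _)
corollary14 G@record { n = suc m ; adj = a ; sym = a-sym ; irrefl = a-irrefl } lr (degs , (u , du) , (s , ds))
  with Degrees13.leaf-structure G lr degs du ds
... | one-leaf w dw others =
  Ĝ , long-refinement lr , degrees , inj₁ refl
  where open NonemptyGraph.LeafDeletion m a a-sym a-irrefl w dw others
... | two-leaves w w' w≢w' dw dw' nonadjacent others =
  G' , long-refinement lr , degrees , inj₂ refl
  where open NonemptyGraph.LeafJoining m a a-sym a-irrefl w w' w≢w' dw dw' nonadjacent others
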